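{- Let $K$ be a number field containing $i=\sqrt{ -1}$ and $E: y^2=x^3+Ax+B$ an elliptic curve over $K$. For $\lambda\in K^*$ put $u(\lambda)=\lambda$, $v(\lambda)=\frac{\lambda^3+A\lambda+2B}{3\lambda}$ (a point of the affine cubic $u^3-3uv+Au+2B=0$), let $$\psi(u,v) = Bu^3 + v^3 + Au^2v - 3Buv - 2Av^2 + ABu + A^2v + B^2,$$ and $\Omega_\lambda := \psi(u(\lambda),v(\lambda))\,(u(\lambda)^2-4v(\lambda))$. Then $\Omega_\lambda$ is a square in $K$ for every $\lambda\in K^*$. Consequently every such rational point $[u(\lambda):v(\lambda):1]$ of $E^2/D_4\cong\mathbb{P}^2$ lifts to $K$-rational points on $E^2/(\mathbb{Z}/4\mathbb{Z})$; that is, each of the (at most two) $\mathbb{Z}/4\mathbb{Z}$-orbits contained in the $D_4$-orbit $\phi^{ -1}([u(\lambda):v(\lambda):1])$ is stable under $\mathrm{Gal}(\overline{K}/K)$.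
   Context: $D_4=\langle r,s\rangle$ acts on $E^2$ by $r(P,Q)=(-Q,P)$, $s(P,Q)=(P,-Q)$, and $\mathbb{Z}/4\mathbb{Z}=\langle r\rangle$. The quotient map $\phi:E^2\to E^2/D_4\cong\mathbb{P}^2$ is given for $P\neq O\neq Q$ by $\phi(P,Q)=[x(P)+x(Q):x(P)x(Q):1]$. For $(P,Q)\in\phi^{ -1}([u:v:1])$ one has $y(P)^2y(Q)^2=\psi(u,v)$ and $(x(P)-x(Q))^2=u^2-4v$, so $\omega(P,Q)^2=\psi(u,v)(u^2-4v)$ where $\omega(P,Q)=y(P)y(Q)(x(P)-x(Q))$ is $\mathbb{Z}/4\mathbb{Z}$-invariant and changes sign under $s$. -}

module Defs where

open import Level using (Level; _⊔_)
open import Algebra.Bundles using (CommutativeRing)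
open import Data.Nat using (ℕ; zero; suc)
open import Data.Integer using (ℤ; +_; -[1+_])
open import Data.Fin using (Fin)
open import Data.Product using (Σ; ∃; _×_)
open import Relation.Nullary using (¬_)

module _ {c ℓ : Level} (K : CommutativeRing c ℓ) where
  open CommutativeRing K

  natK : ℕ → Carrier
  natK zero = 0#
  natK (suc n) = 1# + natK n

  intK : ℤ → Carrier
  intK (+ n) = natK n
  intK -[1+ n ] = - natK (suc n)

  sumK : (n : ℕ) → (Fin n → Carrier) → Carrier
  sumK zero f = 0#
  sumK (suc n) f = f Fin.zero + sumK n (λ j → f (Fin.suc j))

  -- A number field: a field of characteristic 0 that is finite-dimensional
  -- over ℚ (finitely many elements spanning K over ℚ; clearing denominators,
  -- every x satisfies (d+1)·x = Σ cᵢ eᵢ with integers cᵢ).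
  record IsNumberField : Set (c ⊔ ℓ) where
    field
      nontrivial : ¬ (1# ≈ 0#)
      inverse    : ∀ x → ¬ (x ≈ 0#) → ∃ λ y → x * y ≈ 1#
      char0      : ∀ n → ¬ (natK (suc n) ≈ 0#)
      finiteDim  : Σ ℕ λ n → Σ (Fin n → Carrier) λ e →
                     ∀ x → Σ ℕ λ d → Σ (Fin n → ℤ) λ coef →
                       natK (suc d) * x ≈ sumK n (λ j → intK (coef j) * e j)

  psi : (A B u v : Carrier) → Carrier
  psi A B u v =
    B * (u * u * u) + v * v * v + A * (u * u) * v
    - natK 3 * B * u * v - natK 2 * A * (v * v)
    + A * B * u + A * A * v + B * B

  -- v(λ) = (λ³ + Aλ + 2B)/(3λ), given an inverse μ of 3λ
  vOf : (A B lam mu : Carrier) → Carrier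
  vOf A B lam mu = (lam * lam * lam + A * lam + natK 2 * B) * mu

  Omega : (A B lam mu : Carrier) → Carrier
  Omega A B lam mu =
    psi A B lam (vOf A B lam mu) * (lam * lam - natK 4 * vOf A B lam mu)

  discK : (A B : Carrier) → Carrier
  discK A B = natK 4 * (A * A * A) + natK 27 * (B * B)

-- The point (u, v) = (λ, v(λ)) lies on the cubic 3uv = u³ + Au + 2B.  On this
-- cubic both factors of Ω collapse to products of the two cubics
--   p(u) = u³ + 4Au + 8B   and   q(u) = u³ + Au − B :
-- writing ψ in the variable w = 3uv (the homogenised form 27u³ ψ(u, w/3u),
-- a monic cubic in w) and substituting w = u³ + Au + 2B gives
--   27u³ ψ(u, v) = p q²   and   3u (u² − 4v) = −p,
-- hence 81u⁴ Ω = −(p q)².  Multiplying by μ⁴, where 3λμ = 1, shows that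
-- Ω = −(μ² p q)², and since −1 = i² this is the square of i μ² p q.

module Submission where

open import Defs
open import Level using (Level)
open import Algebra.Bundles using (CommutativeRing)
open import Data.Product using (∃; _,_)
open import Relation.Nullary using (¬_)
open import Data.Nat as ℕ using (ℕ; zero; suc)
import Data.Nat.Properties as ℕ
open import Data.Integer as ℤ using (ℤ; +_; -[1+_])
import Data.Integer.Properties as ℤ
import Data.Sign as Sign
open import Data.Maybe using (Maybe; map)
open import Relation.Binary.Consequences using (dec⇒weaklyDec)
import Relation.Binary.PropositionalEquality as ≡
open import Algebra.Solver.Ring.AlmostCommutativeRing
  using (fromCommutativeRing; _-Raw-AlmostCommutative⟶_)
import Algebra.Solver.Ring as RingSolver
import Algebra.Properties.Ring as RingProperties
import Algebra.Properties.Semiring.Mult as SemiringMult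
import Algebra.Properties.CommutativeSemigroup as CommutativeSemigroupProperties
import Relation.Binary.Reasoning.Setoid as SetoidReasoning

module IntegerCoefficients {c ℓ : Level} (K : CommutativeRing c ℓ) where
  open CommutativeRing K
  open RingProperties ring using (-0#≈0#; -‿+-comm; -‿involutive; -‿distribˡ-*; -‿distribʳ-*)
  open SemiringMult semiring using (_×_; ×-homo-+; ×1-homo-*)
  open CommutativeSemigroupProperties +-commutativeSemigroup using (interchange)
  open SetoidReasoning setoid

  natK≈× : ∀ n → natK K n ≈ n × 1#
  natK≈× zero    = refl
  natK≈× (suc n) = +-congˡ (natK≈× n)

  natK-+ : ∀ m n → natK K (m ℕ.+ n) ≈ natK K m + natK K n
  natK-+ m n = begin
    natK K (m ℕ.+ n)         ≈⟨ natK≈× (m ℕ.+ n) ⟩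
    (m ℕ.+ n) × 1#           ≈⟨ ×-homo-+ 1# m n ⟩
    m × 1# + n × 1#          ≈⟨ +-cong (natK≈× m) (natK≈× n) ⟨
    natK K m + natK K n      ∎

  natK-* : ∀ m n → natK K (m ℕ.* n) ≈ natK K m * natK K n
  natK-* m n = begin
    natK K (m ℕ.* n)         ≈⟨ natK≈× (m ℕ.* n) ⟩
    (m ℕ.* n) × 1#           ≈⟨ ×1-homo-* m n ⟩
    (m × 1#) * (n × 1#)      ≈⟨ *-cong (natK≈× m) (natK≈× n) ⟨
    natK K m * natK K n      ∎

  x-0#≈x : ∀ x → x - 0# ≈ x
  x-0#≈x x = trans (+-congˡ -0#≈0#) (+-identityʳ x)

  [z+x]-[z+y]≈x-y : ∀ z x y → (z + x) - (z + y) ≈ x - y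
  [z+x]-[z+y]≈x-y z x y = begin
    (z + x) - (z + y)        ≈⟨ +-congˡ (-‿+-comm z y) ⟨
    (z + x) + (- z + - y)    ≈⟨ interchange z x (- z) (- y) ⟩
    (z - z) + (x - y)        ≈⟨ +-congʳ (-‿inverseʳ z) ⟩
    0# + (x - y)             ≈⟨ +-identityˡ (x - y) ⟩
    x - y                    ∎

  intK-⊖ : ∀ m n → intK K (m ℤ.⊖ n) ≈ natK K m - natK K n
  intK-⊖ zero    zero    = sym (x-0#≈x 0#)
  intK-⊖ zero    (suc n) = sym (+-identityˡ _)
  intK-⊖ (suc m) zero    = sym (x-0#≈x _)
  intK-⊖ (suc m) (suc n) = begin
    intK K (suc m ℤ.⊖ suc n)             ≡⟨ ≡.cong (intK K) (ℤ.[1+m]⊖[1+n]≡m⊖n m n) ⟩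
    intK K (m ℤ.⊖ n)                     ≈⟨ intK-⊖ m n ⟩
    natK K m - natK K n                  ≈⟨ [z+x]-[z+y]≈x-y 1# (natK K m) (natK K n) ⟨
    natK K (suc m) - natK K (suc n)      ∎

  intK-+ : ∀ i j → intK K (i ℤ.+ j) ≈ intK K i + intK K j
  intK-+ (+ m)    (+ n)    = natK-+ m n
  intK-+ (+ m)    -[1+ n ] = intK-⊖ m (suc n)
  intK-+ -[1+ m ] (+ n)    = trans (intK-⊖ n (suc m)) (+-comm _ _)
  intK-+ -[1+ m ] -[1+ n ] = begin
    - natK K (suc (suc (m ℕ.+ n)))       ≡⟨ ≡.cong (λ k → - natK K (suc k)) (ℕ.+-suc m n) ⟨
    - natK K (suc m ℕ.+ suc n)           ≈⟨ -‿cong (natK-+ (suc m) (suc n)) ⟩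
    - (natK K (suc m) + natK K (suc n))  ≈⟨ -‿+-comm _ _ ⟨
    - natK K (suc m) + - natK K (suc n)  ∎

  intK-neg : ∀ i → intK K (ℤ.- i) ≈ - intK K i
  intK-neg (+ zero)  = sym -0#≈0#
  intK-neg (+ suc n) = refl
  intK-neg -[1+ n ]  = sym (-‿involutive _)

  intK-+◃ : ∀ n → intK K (Sign.+ ℤ.◃ n) ≈ natK K n
  intK-+◃ zero    = refl
  intK-+◃ (suc n) = refl

  intK--◃ : ∀ n → intK K (Sign.- ℤ.◃ n) ≈ - natK K n
  intK--◃ zero    = sym -0#≈0#
  intK--◃ (suc n) = refl

  -x*-y≈x*y : ∀ x y → - x * - y ≈ x * y
  -x*-y≈x*y x y = begin
    - x * - y                ≈⟨ -‿distribˡ-* x (- y) ⟨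
    - (x * - y)              ≈⟨ -‿cong (-‿distribʳ-* x y) ⟨
    - - (x * y)              ≈⟨ -‿involutive (x * y) ⟩
    x * y                    ∎

  intK-* : ∀ i j → intK K (i ℤ.* j) ≈ intK K i * intK K j
  intK-* (+ m)    (+ n)    = trans (intK-+◃ (m ℕ.* n)) (natK-* m n)
  intK-* (+ m)    -[1+ n ] = begin
    intK K (Sign.- ℤ.◃ (m ℕ.* suc n))    ≈⟨ intK--◃ (m ℕ.* suc n) ⟩
    - natK K (m ℕ.* suc n)               ≈⟨ -‿cong (natK-* m (suc n)) ⟩
    - (natK K m * natK K (suc n))        ≈⟨ -‿distribʳ-* _ _ ⟩
    natK K m * - natK K (suc n)          ∎
  intK-* -[1+ m ] (+ n)    = begin
    intK K (Sign.- ℤ.◃ (suc m ℕ.* n))    ≈⟨ intK--◃ (suc m ℕ.* n) ⟩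
    - natK K (suc m ℕ.* n)               ≈⟨ -‿cong (natK-* (suc m) n) ⟩
    - (natK K (suc m) * natK K n)        ≈⟨ -‿distribˡ-* _ _ ⟩
    - natK K (suc m) * natK K n          ∎
  intK-* -[1+ m ] -[1+ n ] = begin
    intK K (Sign.+ ℤ.◃ (suc m ℕ.* suc n))   ≈⟨ intK-+◃ (suc m ℕ.* suc n) ⟩
    natK K (suc m ℕ.* suc n)                ≈⟨ natK-* (suc m) (suc n) ⟩
    natK K (suc m) * natK K (suc n)         ≈⟨ -x*-y≈x*y _ _ ⟨
    - natK K (suc m) * - natK K (suc n)     ∎

  intK-morphism : ℤ.+-*-rawRing -Raw-AlmostCommutative⟶ fromCommutativeRing K
  intK-morphism = record
    { ⟦_⟧    = intK K
    ; +-homo = intK-+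
    ; *-homo = intK-*
    ; -‿homo = intK-neg
    ; 0-homo = refl
    ; 1-homo = +-identityʳ 1#
    }

  -- Equal integers have equal images; enough to let the solver compare coefficients.
  intK-weaklyDec : ∀ i j → Maybe (intK K i ≈ intK K j)
  intK-weaklyDec i j = map (λ { ≡.refl → refl }) (dec⇒weaklyDec ℤ._≟_ i j)

  open RingSolver ℤ.+-*-rawRing (fromCommutativeRing K) intK-morphism intK-weaklyDec public

module OnTheCubic {c ℓ : Level} (K : CommutativeRing c ℓ) where
  open CommutativeRing K
  open IntegerCoefficients K using (Polynomial; solve; con; _:+_; _:-_; _:*_; :-_)
  open SetoidReasoning setoid

  cubic : (A B u : Carrier) → Carrier
  cubic A B u = u * u * u + A * u + natK K 2 * B

  OnCubic : (A B u v : Carrier) → Set ℓ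
  OnCubic A B u v = natK K 3 * u * v ≈ cubic A B u

  p : (A B u : Carrier) → Carrier
  p A B u = u * u * u + natK K 4 * A * u + natK K 8 * B

  q : (A B u : Carrier) → Carrier
  q A B u = u * u * u + A * u - B

  -- 27u³ ψ(u, w/3u): ψ rewritten in the variable w = 3uv, a monic cubic in w
  psiHom : (A B u w : Carrier) → Carrier
  psiHom A B u w =
    natK K 27 * B * (u * u * u) * (u * u * u + A * u + B)
    + w * (natK K 9 * (u * u) * (A * (u * u) - natK K 3 * B * u + A * A)
           + w * (w - natK K 6 * A * u))

  private module Syntax {n : ℕ} (A B u : Polynomial n) where
    cubicₚ pₚ qₚ : Polynomial n
    cubicₚ = u :* u :* u :+ A :* u :+ con (+ 2) :* B
    pₚ = u :* u :* u :+ con (+ 4) :* A :* u :+ con (+ 8) :* B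
    qₚ = u :* u :* u :+ A :* u :- B

    psiₚ psiHomₚ : Polynomial n → Polynomial n
    psiₚ v = B :* (u :* u :* u) :+ v :* v :* v :+ A :* (u :* u) :* v
      :- con (+ 3) :* B :* u :* v :- con (+ 2) :* A :* (v :* v)
      :+ A :* B :* u :+ A :* A :* v :+ B :* B
    psiHomₚ w =
      con (+ 27) :* B :* (u :* u :* u) :* (u :* u :* u :+ A :* u :+ B)
      :+ w :* (con (+ 9) :* (u :* u) :* (A :* (u :* u) :- con (+ 3) :* B :* u :+ A :* A)
               :+ w :* (w :- con (+ 6) :* A :* u))
  open Syntax

  psi-homogenise : ∀ A B u v →
    natK K 27 * (u * u * u) * psi K A B u v ≈ psiHom A B u (natK K 3 * u * v)
  psi-homogenise = solve 4 (λ A B u v →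
    con (+ 27) :* (u :* u :* u) :* psiₚ A B u v , psiHomₚ A B u (con (+ 3) :* u :* v)) refl

  psiHom-cong : ∀ A B u {w w′} → w ≈ w′ → psiHom A B u w ≈ psiHom A B u w′
  psiHom-cong A B u w≈w′ =
    +-congˡ (*-cong w≈w′ (+-congˡ (*-cong w≈w′ (+-congʳ w≈w′))))

  psiHom-at-cubic : ∀ A B u → psiHom A B u (cubic A B u) ≈ p A B u * (q A B u * q A B u)
  psiHom-at-cubic = solve 3 (λ A B u →
    psiHomₚ A B u (cubicₚ A B u) , pₚ A B u :* (qₚ A B u :* qₚ A B u)) refl

  psi-on-cubic : ∀ {A B u v} → OnCubic A B u v →
    natK K 27 * (u * u * u) * psi K A B u v ≈ p A B u * (q A B u * q A B u)
  psi-on-cubic {A} {B} {u} {v} on = begin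
    natK K 27 * (u * u * u) * psi K A B u v   ≈⟨ psi-homogenise A B u v ⟩
    psiHom A B u (natK K 3 * u * v)           ≈⟨ psiHom-cong A B u on ⟩
    psiHom A B u (cubic A B u)                ≈⟨ psiHom-at-cubic A B u ⟩
    p A B u * (q A B u * q A B u)             ∎

  linear-on-cubic : ∀ {A B u v} → OnCubic A B u v →
    natK K 3 * u * (u * u - natK K 4 * v) ≈ - p A B u
  linear-on-cubic {A} {B} {u} {v} on = begin
    natK K 3 * u * (u * u - natK K 4 * v)                  ≈⟨ homogenise u v ⟩
    natK K 3 * (u * u * u) - natK K 4 * (natK K 3 * u * v) ≈⟨ +-congˡ (-‿cong (*-congˡ on)) ⟩
    natK K 3 * (u * u * u) - natK K 4 * cubic A B u        ≈⟨ at-cubic A B u ⟩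
    - p A B u                                              ∎
    where
    homogenise : ∀ u v → natK K 3 * u * (u * u - natK K 4 * v)
                         ≈ natK K 3 * (u * u * u) - natK K 4 * (natK K 3 * u * v)
    homogenise = solve 2 (λ u v →
      con (+ 3) :* u :* (u :* u :- con (+ 4) :* v)
      , con (+ 3) :* (u :* u :* u) :- con (+ 4) :* (con (+ 3) :* u :* v)) refl
    at-cubic : ∀ A B u → natK K 3 * (u * u * u) - natK K 4 * cubic A B u ≈ - p A B u
    at-cubic = solve 3 (λ A B u →
      con (+ 3) :* (u :* u :* u) :- con (+ 4) :* cubicₚ A B u , :- pₚ A B u) refl

  Omega-factors-on-cubic : ∀ {A B u v} → OnCubic A B u v →
    (natK K 27 * (u * u * u) * psi K A B u v) * (natK K 3 * u * (u * u - natK K 4 * v))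
      ≈ - ((p A B u * q A B u) * (p A B u * q A B u))
  Omega-factors-on-cubic {A} {B} {u} on =
    trans (*-cong (psi-on-cubic on) (linear-on-cubic on)) (rearrange (p A B u) (q A B u))
    where
    rearrange : ∀ x y → x * (y * y) * - x ≈ - ((x * y) * (x * y))
    rearrange = solve 2 (λ x y → x :* (y :* y) :* :- x , :- ((x :* y) :* (x :* y))) refl

  vOf-on-cubic : ∀ A B lam mu → natK K 3 * lam * mu ≈ 1# → OnCubic A B lam (vOf K A B lam mu)
  vOf-on-cubic A B lam mu 3λμ≈1 = begin
    natK K 3 * lam * (cubic A B lam * mu)   ≈⟨ regroup (natK K 3 * lam) (cubic A B lam) mu ⟩
    cubic A B lam * (natK K 3 * lam * mu)   ≈⟨ *-congˡ 3λμ≈1 ⟩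
    cubic A B lam * 1#                      ≈⟨ *-identityʳ _ ⟩
    cubic A B lam                           ∎
    where
    regroup : ∀ x y z → x * (y * z) ≈ y * (x * z)
    regroup = solve 3 (λ x y z → x :* (y :* z) , y :* (x :* z)) refl

  Omega-negated-square : ∀ A B lam mu → natK K 3 * lam * mu ≈ 1# →
    let s = mu * mu * (p A B lam * q A B lam) in Omega K A B lam mu ≈ - (s * s)
  Omega-negated-square A B lam mu 3λμ≈1 = begin
    Ω                                          ≈⟨ *-identityˡ Ω ⟨
    1# * Ω                                     ≈⟨ *-congʳ t⁴≈1 ⟨
    t * t * (t * t) * Ω                        ≈⟨ clear-denominators lam mu ψ v ⟩
    mu * mu * (mu * mu) * (27λ³ψ * 3λ[λ²-4v])  ≈⟨ *-congˡ (Omega-factors-on-cubic (vOf-on-cubic A B lam mu 3λμ≈1)) ⟩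
    mu * mu * (mu * mu) * - (P * P)            ≈⟨ square-out (mu * mu) P ⟩
    - (mu * mu * P * (mu * mu * P))            ∎
    where
    Ω v ψ 27λ³ψ 3λ[λ²-4v] P t : Carrier
    Ω = Omega K A B lam mu
    v = vOf K A B lam mu
    ψ = psi K A B lam v
    27λ³ψ = natK K 27 * (lam * lam * lam) * ψ
    3λ[λ²-4v] = natK K 3 * lam * (lam * lam - natK K 4 * v)
    P = p A B lam * q A B lam
    -- t = 3λμ = 1 clears the denominators of v(λ) = c(λ)/3λ
    t = natK K 3 * lam * mu
    t²≈1 : t * t ≈ 1#
    t²≈1 = trans (*-cong 3λμ≈1 3λμ≈1) (*-identityˡ 1#)
    t⁴≈1 : t * t * (t * t) ≈ 1#
    t⁴≈1 = trans (*-cong t²≈1 t²≈1) (*-identityˡ 1#)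
    clear-denominators : ∀ l m x w →
      natK K 3 * l * m * (natK K 3 * l * m) * (natK K 3 * l * m * (natK K 3 * l * m)) * (x * (l * l - natK K 4 * w))
        ≈ m * m * (m * m) * ((natK K 27 * (l * l * l) * x) * (natK K 3 * l * (l * l - natK K 4 * w)))
    clear-denominators = solve 4 (λ l m x w →
      let t = con (+ 3) :* l :* m in
      t :* t :* (t :* t) :* (x :* (l :* l :- con (+ 4) :* w))
      , m :* m :* (m :* m) :* ((con (+ 27) :* (l :* l :* l) :* x) :* (con (+ 3) :* l :* (l :* l :- con (+ 4) :* w)))) refl
    square-out : ∀ x y → x * x * - (y * y) ≈ - (x * y * (x * y))
    square-out = solve 2 (λ x y → x :* x :* :- (y :* y) , :- (x :* y :* (x :* y))) refl

module SquareRootOfMinusOne {c ℓ : Level} (K : CommutativeRing c ℓ) where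
  open CommutativeRing K
  open RingProperties ring using (-1*x≈-x)
  open CommutativeSemigroupProperties *-commutativeSemigroup using (interchange)
  open SetoidReasoning setoid

  negated-square-is-square : ∀ {i x} s → i * i ≈ - 1# → x ≈ - (s * s) → (i * s) * (i * s) ≈ x
  negated-square-is-square {i} {x} s i²≈-1 x≈-s² = begin
    (i * s) * (i * s)      ≈⟨ interchange i s i s ⟩
    (i * i) * (s * s)      ≈⟨ *-congʳ i²≈-1 ⟩
    - 1# * (s * s)         ≈⟨ -1*x≈-x (s * s) ⟩
    - (s * s)              ≈⟨ x≈-s² ⟨
    x                      ∎

proposition4p7 : {c ℓ : Level} (K : CommutativeRing c ℓ) → IsNumberField K →
    (i : CommutativeRing.Carrier K) →
    CommutativeRing._≈_ K (CommutativeRing._*_ K i i) (CommutativeRing.-_ K (CommutativeRing.1# K)) →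
    (A B : CommutativeRing.Carrier K) →
    ¬ (CommutativeRing._≈_ K (discK K A B) (CommutativeRing.0# K)) →
    (lam mu : CommutativeRing.Carrier K) →
    ¬ (CommutativeRing._≈_ K lam (CommutativeRing.0# K)) →
    CommutativeRing._≈_ K (CommutativeRing._*_ K (CommutativeRing._*_ K (natK K 3) lam) mu) (CommutativeRing.1# K) →
    ∃ λ w → CommutativeRing._≈_ K (CommutativeRing._*_ K w w) (Omega K A B lam mu)
proposition4p7 K _ i i²≈-1 A B _ lam mu _ 3λμ≈1 =
  i * s , negated-square-is-square s i²≈-1 (Omega-negated-square A B lam mu 3λμ≈1)
  where
  open CommutativeRing K using (_*_)
  open OnTheCubic K using (p; q; Omega-negated-square)
  open SquareRootOfMinusOne K using (negated-square-is-square)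
  -- the square root of −Ω_λ: μ² p(λ) q(λ) = p(λ) q(λ) / 9λ²
  s : CommutativeRing.Carrier K
  s = mu * mu * (p A B lam * q A B lam)
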